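{- For every theory $T$ and formula $A$: $T\vdash_{\mathsf{SE}} A$ if and only if $T'\vdash_{\mathsf{CL}} A'$.
   Context: Syntax of $\mathsf{SE}$: countably infinite sets of justification constants $\mathsf{JConst}=\{0,1,c_1,\dots\}$, variables $\mathsf{JVar}$; terms $\mathsf{Tm}$: constants, variables, $s\cdot t$, $s+t$; formulas $\mathsf{Fml}$: $\bot$, atoms $P\in\mathsf{Prop}$, $A\to B$, $t:A$. $A[w/t]$ replaces the variable $w$ by $t$; $A\sigma$ for $\sigma:\mathsf{JVar}\to\mathsf{Tm}$ replaces simultaneously each $x$ by $\sigma(x)$. Axioms of $\mathsf{SE}$ (for all formulas $A,B$, variables $w,x,y,z$): (CL) propositional tautologies; (j) $x:(A\to B)\to(y:A\to x\cdot y:B)$; (j+) $x:A\wedge y:A\to(x+y):A$; (a+) $A[w/(x+y)+z]\to A[w/x+(y+z)]$; (c+) $A[w/x+y]\to A[w/y+x]$; (0+) $A[w/x+0]\leftrightarrow A[w/x]$; (am) $A[w/(x\cdot y)\cdot z]\leftrightarrow A[w/x\cdot(y\cdot z)]$; (a0) $A[w/x\cdot 0]\leftrightarrow A[w/0]$, $A[w/0\cdot x]\leftrightarrow A[w/0]$; (a1) $A[w/x\cdot 1]\leftrightarrow A[w/x]$, $A[w/1\cdot x]\leftrightarrow A[w/x]$; (dl) $A[w/x\cdot(y+z)]\leftrightarrow A[w/x\cdot y+x\cdot z]$; (dr) $A[w/(y+z)\cdot x]\leftrightarrow A[w/y\cdot x+z\cdot x]$. Rules: modus ponens and (jv): from $A$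 infer $A[x/t]$. A theory is a set $T$ of formulas; $T\vdash_{\mathsf{SE}}F$: $F$ derivable from axioms and members of $T$ by these rules. $[t]$ is the class of term $t$ modulo the semiring equalities ($+$ associative, commutative, neutral $0$; $\cdot$ associative, neutral $1$; distributivity; $0$ absorbing), $S_{\mathsf{Tm}}$ the set of such classes; $\mathsf{Fml}_{S_{\mathsf{Tm}}}$ the formulas with elements of $S_{\mathsf{Tm}}$ in place of terms, and $[\bot]=\bot$, $[P]=P$, $[A\to B]=[A]\to[B]$, $[t:A]=[t]:[A]$. Let $\mathsf{Prop}_2$ be an infinite set of new atomic propositions disjoint from $\mathsf{Prop}$ and $f:S_{\mathsf{Tm}}\times\mathsf{Fml}_{S_{\mathsf{Tm}}}\to\mathsf{Prop}_2$ a fixed bijection. The translation $'$: $\bot'=\bot$, $P'=P$, $(A\to B)'=A'\to B'$, $(t:A)'=f([t],[A])$. $T'=\{(A\sigma)'\mid A\in T \text{ or } A \text{ an axiom of } \mathsf{SE},\ \sigma:\mathsf{JVar}\to\mathsf{Tm}\}$. $T'\vdash_{\mathsf{CL}}B$ means $B$ is derivable in classical propositional logic (over atoms $\mathsf{Prop}\cup\mathsf{Prop}_2$) from the set $T'$. -}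

module Defs where

open import Data.Nat using (ℕ; _≟_)
open import Data.Bool using (Bool; true; false; if_then_else_)
open import Data.Sum using (_⊎_; inj₁; inj₂)
open import Data.Product using (Σ; _×_; _,_)
open import Relation.Nullary using (does)
open import Relation.Binary.PropositionalEquality using (_≡_)

Prop : Set
Prop = ℕ

JVar : Set
JVar = ℕ

infixl 7 _·_
infixl 6 _⊕_

data Tm : Set where
  var  : JVar → Tm
  𝟘    : Tm
  𝟙    : Tm
  cst  : ℕ → Tm
  _·_  : Tm → Tm → Tm
  _⊕_  : Tm → Tm → Tm

infixr 5 _⇒_
infix 6 _∶_

data Fml : Set where
  ⊥′   : Fml
  atom : Prop → Fml
  _⇒_  : Fml → Fml → Fml
  _∶_  : Tm → Fml → Fml

¬′_ : Fml → Fml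
¬′ A = A ⇒ ⊥′

infixr 4 _∧′_
_∧′_ : Fml → Fml → Fml
A ∧′ B = ¬′ (A ⇒ ¬′ B)

infix 3 _⇔′_
_⇔′_ : Fml → Fml → Fml
A ⇔′ B = (A ⇒ B) ∧′ (B ⇒ A)

substTm : (JVar → Tm) → Tm → Tm
substTm σ (var x) = σ x
substTm σ 𝟘 = 𝟘
substTm σ 𝟙 = 𝟙
substTm σ (cst n) = cst n
substTm σ (s · t) = substTm σ s · substTm σ t
substTm σ (s ⊕ t) = substTm σ s ⊕ substTm σ t

_[_] : Fml → (JVar → Tm) → Fml
⊥′ [ σ ] = ⊥′
atom P [ σ ] = atom P
(A ⇒ B) [ σ ] = (A [ σ ]) ⇒ (B [ σ ])
(t ∶ A) [ σ ] = substTm σ t ∶ (A [ σ ])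

single : JVar → Tm → JVar → Tm
single w t x = if does (x ≟ w) then t else var x

_[_/_] : Fml → JVar → Tm → Fml
A [ w / t ] = A [ single w t ]

-- Propositional tautologies of the SE language
-- (justification formulas t:A treated as atoms)

evalSE : (Prop → Bool) → (Tm → Fml → Bool) → Fml → Bool
evalSE v u ⊥′ = false
evalSE v u (atom P) = v P
evalSE v u (A ⇒ B) = if evalSE v u A then evalSE v u B else true
evalSE v u (t ∶ A) = u t A

TautSE : Fml → Set
TautSE A = (v : Prop → Bool) (u : Tm → Fml → Bool) → evalSE v u A ≡ true

data Axiom : Fml → Set where
  ax-CL  : ∀ {A} → TautSE A → Axiom A
  ax-j   : ∀ A B (x y : JVar) →
           Axiom (var x ∶ (A ⇒ B) ⇒ (var y ∶ A ⇒ (var x · var y) ∶ B))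
  ax-j+  : ∀ A (x y : JVar) →
           Axiom ((var x ∶ A ∧′ var y ∶ A) ⇒ (var x ⊕ var y) ∶ A)
  ax-a+  : ∀ A (w x y z : JVar) →
           Axiom (A [ w / (var x ⊕ var y) ⊕ var z ] ⇒ A [ w / var x ⊕ (var y ⊕ var z) ])
  ax-c+  : ∀ A (w x y : JVar) →
           Axiom (A [ w / var x ⊕ var y ] ⇒ A [ w / var y ⊕ var x ])
  ax-0+  : ∀ A (w x : JVar) →
           Axiom (A [ w / var x ⊕ 𝟘 ] ⇔′ A [ w / var x ])
  ax-am  : ∀ A (w x y z : JVar) →
           Axiom (A [ w / (var x · var y) · var z ] ⇔′ A [ w / var x · (var y · var z) ])
  ax-a0r : ∀ A (w x : JVar) →
           Axiom (A [ w / var x · 𝟘 ] ⇔′ A [ w / 𝟘 ])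
  ax-a0l : ∀ A (w x : JVar) →
           Axiom (A [ w / 𝟘 · var x ] ⇔′ A [ w / 𝟘 ])
  ax-a1r : ∀ A (w x : JVar) →
           Axiom (A [ w / var x · 𝟙 ] ⇔′ A [ w / var x ])
  ax-a1l : ∀ A (w x : JVar) →
           Axiom (A [ w / 𝟙 · var x ] ⇔′ A [ w / var x ])
  ax-dl  : ∀ A (w x y z : JVar) →
           Axiom (A [ w / var x · (var y ⊕ var z) ] ⇔′ A [ w / var x · var y ⊕ var x · var z ])
  ax-dr  : ∀ A (w x y z : JVar) →
           Axiom (A [ w / (var y ⊕ var z) · var x ] ⇔′ A [ w / var y · var x ⊕ var z · var x ])

Theory : Set₁
Theory = Fml → Set

infix 2 _⊢SE_
data _⊢SE_ (T : Theory) : Fml → Set where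
  axiom : ∀ {A} → Axiom A → T ⊢SE A
  hyp   : ∀ {A} → T A → T ⊢SE A
  mp    : ∀ {A B} → T ⊢SE (A ⇒ B) → T ⊢SE A → T ⊢SE B
  jv    : ∀ {A} (x : JVar) (t : Tm) → T ⊢SE A → T ⊢SE (A [ x / t ])

-- Semiring equality on terms ([t] = class of t modulo ≈t)

infix 4 _≈t_
data _≈t_ : Tm → Tm → Set where
  ≈refl   : ∀ {s} → s ≈t s
  ≈sym    : ∀ {s t} → s ≈t t → t ≈t s
  ≈trans  : ∀ {s t u} → s ≈t t → t ≈t u → s ≈t u
  ⊕-cong  : ∀ {s s′ t t′} → s ≈t s′ → t ≈t t′ → s ⊕ t ≈t s′ ⊕ t′
  ·-cong  : ∀ {s s′ t t′} → s ≈t s′ → t ≈t t′ → s · t ≈t s′ · t′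
  ⊕-assoc : ∀ s t u → (s ⊕ t) ⊕ u ≈t s ⊕ (t ⊕ u)
  ⊕-comm  : ∀ s t → s ⊕ t ≈t t ⊕ s
  ⊕-idʳ   : ∀ s → s ⊕ 𝟘 ≈t s
  ·-assoc : ∀ s t u → (s · t) · u ≈t s · (t · u)
  ·-idˡ   : ∀ s → 𝟙 · s ≈t s
  ·-idʳ   : ∀ s → s · 𝟙 ≈t s
  distˡ   : ∀ s t u → s · (t ⊕ u) ≈t s · t ⊕ s · u
  distʳ   : ∀ s t u → (t ⊕ u) · s ≈t t · s ⊕ u · s
  zeroˡ   : ∀ s → 𝟘 · s ≈t 𝟘
  zeroʳ   : ∀ s → s · 𝟘 ≈t 𝟘

-- [A] = [B] : same formula up to replacing terms by semiring-equal terms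
infix 4 _≈f_
data _≈f_ : Fml → Fml → Set where
  ⊥≈   : ⊥′ ≈f ⊥′
  atom≈ : ∀ P → atom P ≈f atom P
  ⇒≈   : ∀ {A A′ B B′} → A ≈f A′ → B ≈f B′ → (A ⇒ B) ≈f (A′ ⇒ B′)
  ∶≈   : ∀ {s t A B} → s ≈t t → A ≈f B → (s ∶ A) ≈f (t ∶ B)

infixr 5 _⇒ᶜ_
data PF (X : Set) : Set where
  ⊥ᶜ    : PF X
  atomᶜ : X → PF X
  _⇒ᶜ_  : PF X → PF X → PF X

evalᶜ : {X : Set} → (X → Bool) → PF X → Bool
evalᶜ v ⊥ᶜ = false
evalᶜ v (atomᶜ p) = v p
evalᶜ v (A ⇒ᶜ B) = if evalᶜ v A then evalᶜ v B else true

Tautᶜ : {X : Set} → PF X → Set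
Tautᶜ {X} A = (v : X → Bool) → evalᶜ v A ≡ true

infix 2 _⊢CL_
data _⊢CL_ {X : Set} (Γ : PF X → Set) : PF X → Set where
  taut : ∀ {A} → Tautᶜ A → Γ ⊢CL A
  hyp  : ∀ {A} → Γ A → Γ ⊢CL A
  mp   : ∀ {A B} → Γ ⊢CL (A ⇒ᶜ B) → Γ ⊢CL A → Γ ⊢CL B

-- The map f∘([_],[_]) : Tm × Fml → Prop₂ is represented by
-- F : Tm → Fml → Prop₂ which induces a bijection
-- S_Tm × Fml_{S_Tm} → Prop₂ (see IsClassBijection).

IsClassBijection : (Prop₂ : Set) → (Tm → Fml → Prop₂) → Set
IsClassBijection Prop₂ F =
  ((s t : Tm) (A B : Fml) → F s A ≡ F t B → (s ≈t t × A ≈f B)) ×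
  ((s t : Tm) (A B : Fml) → (s ≈t t × A ≈f B) → F s A ≡ F t B) ×
  ((p : Prop₂) → Σ Tm (λ t → Σ Fml (λ A → F t A ≡ p)))

tr : {Prop₂ : Set} → (Tm → Fml → Prop₂) → Fml → PF (Prop ⊎ Prop₂)
tr F ⊥′ = ⊥ᶜ
tr F (atom P) = atomᶜ (inj₁ P)
tr F (A ⇒ B) = tr F A ⇒ᶜ tr F B
tr F (t ∶ A) = atomᶜ (inj₂ (F t A))

prime : {Prop₂ : Set} → (Tm → Fml → Prop₂) → Theory → PF (Prop ⊎ Prop₂) → Set
prime F T B = Σ Fml (λ A → Σ (JVar → Tm) (λ σ →
                (T A ⊎ Axiom A) × (B ≡ tr F (A [ σ ]))))

-- Forward: T′ contains every substitution instance of T and of the axioms, so the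
-- translation of an SE derivation is a CL derivation (an application of (jv) only
-- changes which instance is used).
-- Backward: read each atom of Prop₂ back as a chosen preimage t : A under F; a CL
-- derivation then becomes an SE derivation by tautologies and modus ponens, except
-- that a hypothesis (Aσ)′ reads back to a formula equal to Aσ only up to semiring
-- equality of terms. Two facts bridge this: simultaneous substitution is admissible
-- in SE (iterate (jv) through fresh variables), and semiring-equal terms are
-- interchangeable in every context, because each semiring law is an instance of an
-- axiom schema of SE, instantiated at arbitrary terms by simultaneous substitution.
module Submission where

open import Defs
open import Data.Bool using (Bool; true; false; if_then_else_)
open import Data.List using (List; []; _∷_)
open import Data.Nat using (ℕ; zero; suc; _+_; _∸_; _⊔_; _≤_; _<_; _≟_; _<?_; s≤s⁻¹)
open import Data.Nat.Properties
open import Data.Product using (Σ; _×_; _,_; proj₁; proj₂; uncurry)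
open import Data.Sum using (_⊎_; inj₁; inj₂; [_,_]′)
open import Function using (_∘_)
open import Relation.Nullary using (Dec; does; ¬_)
open import Relation.Nullary.Decidable using (dec-true; dec-false; yes; no)
open import Relation.Binary.PropositionalEquality hiding ([_])
open ≡-Reasoning

private variable
  T : Theory
  A B C : Fml

module _ {P : Set} (d : Dec P) {a b : Tm} where
  if-yes : P → (if does d then a else b) ≡ a
  if-yes p = cong (if_then a else b) (dec-true d p)

  if-no : ¬ P → (if does d then a else b) ≡ b
  if-no ¬p = cong (if_then a else b) (dec-false d ¬p)

single-same : ∀ w t → single w t w ≡ t
single-same w t = if-yes (w ≟ w) refl

single-other : ∀ {w v} t → v ≢ w → single w t v ≡ var v
single-other {w} {v} t = if-no (v ≟ w)

boundTm : Tm → ℕ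
boundTm (var x) = suc x
boundTm 𝟘 = 0
boundTm 𝟙 = 0
boundTm (cst _) = 0
boundTm (s · t) = boundTm s ⊔ boundTm t
boundTm (s ⊕ t) = boundTm s ⊔ boundTm t

boundFml : Fml → ℕ
boundFml ⊥′ = 0
boundFml (atom _) = 0
boundFml (A ⇒ B) = boundFml A ⊔ boundFml B
boundFml (t ∶ A) = boundTm t ⊔ boundFml A

AgreeBelow : ℕ → (JVar → Tm) → (JVar → Tm) → Set
AgreeBelow n σ τ = ∀ v → v < n → σ v ≡ τ v

module _ {σ τ : JVar → Tm} where
  agreeBelow-⊔ˡ : ∀ {m} n → AgreeBelow (m ⊔ n) σ τ → AgreeBelow m σ τ
  agreeBelow-⊔ˡ n agree v v<m = agree v (m<n⇒m<n⊔o n v<m)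

  agreeBelow-⊔ʳ : ∀ m {n} → AgreeBelow (m ⊔ n) σ τ → AgreeBelow n σ τ
  agreeBelow-⊔ʳ m agree v v<n = agree v (m<n⇒m<o⊔n m v<n)

substTm-ext : ∀ σ τ t → AgreeBelow (boundTm t) σ τ → substTm σ t ≡ substTm τ t
substTm-ext σ τ (var x) agree = agree x (n<1+n x)
substTm-ext σ τ 𝟘 agree = refl
substTm-ext σ τ 𝟙 agree = refl
substTm-ext σ τ (cst _) agree = refl
substTm-ext σ τ (s · t) agree =
  cong₂ _·_ (substTm-ext σ τ s (agreeBelow-⊔ˡ _ agree)) (substTm-ext σ τ t (agreeBelow-⊔ʳ (boundTm s) agree))
substTm-ext σ τ (s ⊕ t) agree =
  cong₂ _⊕_ (substTm-ext σ τ s (agreeBelow-⊔ˡ _ agree)) (substTm-ext σ τ t (agreeBelow-⊔ʳ (boundTm s) agree))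

[]-ext : ∀ σ τ A → AgreeBelow (boundFml A) σ τ → A [ σ ] ≡ A [ τ ]
[]-ext σ τ ⊥′ agree = refl
[]-ext σ τ (atom _) agree = refl
[]-ext σ τ (A ⇒ B) agree =
  cong₂ _⇒_ ([]-ext σ τ A (agreeBelow-⊔ˡ _ agree)) ([]-ext σ τ B (agreeBelow-⊔ʳ (boundFml A) agree))
[]-ext σ τ (t ∶ A) agree =
  cong₂ _∶_ (substTm-ext σ τ t (agreeBelow-⊔ˡ _ agree)) ([]-ext σ τ A (agreeBelow-⊔ʳ (boundTm t) agree))

substTm-∘ : ∀ ρ σ t → substTm σ (substTm ρ t) ≡ substTm (substTm σ ∘ ρ) t
substTm-∘ ρ σ (var x) = refl
substTm-∘ ρ σ 𝟘 = refl
substTm-∘ ρ σ 𝟙 = refl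
substTm-∘ ρ σ (cst _) = refl
substTm-∘ ρ σ (s · t) = cong₂ _·_ (substTm-∘ ρ σ s) (substTm-∘ ρ σ t)
substTm-∘ ρ σ (s ⊕ t) = cong₂ _⊕_ (substTm-∘ ρ σ s) (substTm-∘ ρ σ t)

[]-∘ : ∀ ρ σ A → (A [ ρ ]) [ σ ] ≡ A [ substTm σ ∘ ρ ]
[]-∘ ρ σ ⊥′ = refl
[]-∘ ρ σ (atom _) = refl
[]-∘ ρ σ (A ⇒ B) = cong₂ _⇒_ ([]-∘ ρ σ A) ([]-∘ ρ σ B)
[]-∘ ρ σ (t ∶ A) = cong₂ _∶_ (substTm-∘ ρ σ t) ([]-∘ ρ σ A)

substTm-var : ∀ t → substTm var t ≡ t
substTm-var (var x) = refl
substTm-var 𝟘 = refl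
substTm-var 𝟙 = refl
substTm-var (cst _) = refl
substTm-var (s · t) = cong₂ _·_ (substTm-var s) (substTm-var t)
substTm-var (s ⊕ t) = cong₂ _⊕_ (substTm-var s) (substTm-var t)

[]-var : ∀ A → A [ var ] ≡ A
[]-var ⊥′ = refl
[]-var (atom _) = refl
[]-var (A ⇒ B) = cong₂ _⇒_ ([]-var A) ([]-var B)
[]-var (t ∶ A) = cong₂ _∶_ (substTm-var t) ([]-var A)

single-fixes-below : ∀ {x} s {n} → n ≤ x → AgreeBelow n (single x s) var
single-fixes-below s n≤x v v<n = single-other s (<⇒≢ (<-≤-trans v<n n≤x))

substTm-fresh : ∀ {x} s t → boundTm t ≤ x → substTm (single x s) t ≡ t
substTm-fresh s t t≤x = trans (substTm-ext _ var t (single-fixes-below s t≤x)) (substTm-var t)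

[]-identity : ∀ σ A → AgreeBelow (boundFml A) σ var → A [ σ ] ≡ A
[]-identity σ A σ-fixes = trans ([]-ext σ var A σ-fixes) ([]-var A)

[]-fresh : ∀ {x} s A → boundFml A ≤ x → A [ x / s ] ≡ A
[]-fresh s A A≤x = []-identity _ A (single-fixes-below s A≤x)

[/]-subst : ∀ C w P σ → AgreeBelow (boundFml C) σ var →
            (C [ w / P ]) [ σ ] ≡ C [ w / substTm σ P ]
[/]-subst C w P σ σ-fixes = trans ([]-∘ (single w P) σ C) ([]-ext _ _ C pointwise)
  where
  pointwise : AgreeBelow (boundFml C) (substTm σ ∘ single w P) (single w (substTm σ P))
  pointwise v v<C with v ≟ w
  ... | yes refl = trans (cong (substTm σ) (single-same v P)) (sym (single-same v (substTm σ P)))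
  ... | no v≢w = begin
    substTm σ (single w P v)     ≡⟨ cong (substTm σ) (single-other P v≢w) ⟩
    σ v                          ≡⟨ σ-fixes v v<C ⟩
    var v                        ≡⟨ single-other (substTm σ P) v≢w ⟨
    single w (substTm σ P) v     ∎

infixr 5 _⇒ᵇ_
_⇒ᵇ_ : Bool → Bool → Bool
a ⇒ᵇ b = if a then b else true

⇒ᵇ-refl : ∀ a → a ⇒ᵇ a ≡ true
⇒ᵇ-refl false = refl
⇒ᵇ-refl true = refl

⇒ᵇ-trans : ∀ a b c → (a ⇒ᵇ b) ⇒ᵇ (b ⇒ᵇ c) ⇒ᵇ a ⇒ᵇ c ≡ true
⇒ᵇ-trans false false _ = refl
⇒ᵇ-trans false true false = refl
⇒ᵇ-trans false true true = refl
⇒ᵇ-trans true false _ = refl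
⇒ᵇ-trans true true false = refl
⇒ᵇ-trans true true true = refl

∧ᵇ-proj₁ : ∀ a b → ((a ⇒ᵇ b ⇒ᵇ false) ⇒ᵇ false) ⇒ᵇ a ≡ true
∧ᵇ-proj₁ false _ = refl
∧ᵇ-proj₁ true false = refl
∧ᵇ-proj₁ true true = refl

∧ᵇ-proj₂ : ∀ a b → ((a ⇒ᵇ b ⇒ᵇ false) ⇒ᵇ false) ⇒ᵇ b ≡ true
∧ᵇ-proj₂ false _ = refl
∧ᵇ-proj₂ true false = refl
∧ᵇ-proj₂ true true = refl

tautology : TautSE A → T ⊢SE A
tautology = axiom ∘ ax-CL

⇒-refl : ∀ A → T ⊢SE A ⇒ A
⇒-refl A = tautology λ v u → ⇒ᵇ-refl (evalSE v u A)

⇒-trans : T ⊢SE A ⇒ B → T ⊢SE B ⇒ C → T ⊢SE A ⇒ C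
⇒-trans {A = A} {B} {C} A⇒B B⇒C =
  mp (mp (tautology λ v u → ⇒ᵇ-trans (evalSE v u A) (evalSE v u B) (evalSE v u C)) A⇒B) B⇒C

∧′-proj₁ : T ⊢SE A ∧′ B → T ⊢SE A
∧′-proj₁ {A = A} {B} = mp (tautology λ v u → ∧ᵇ-proj₁ (evalSE v u A) (evalSE v u B))

∧′-proj₂ : T ⊢SE A ∧′ B → T ⊢SE B
∧′-proj₂ {A = A} {B} = mp (tautology λ v u → ∧ᵇ-proj₂ (evalSE v u A) (evalSE v u B))

_↾_ : (JVar → Tm) → ℕ → JVar → Tm
(σ ↾ n) v = if does (v <? n) then σ v else var v

↾-below : ∀ σ {n v} → v < n → (σ ↾ n) v ≡ σ v
↾-below σ {n} {v} = if-yes (v <? n)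

↾-above : ∀ σ {n v} → ¬ v < n → (σ ↾ n) v ≡ var v
↾-above σ {n} {v} = if-no (v <? n)

boundSubst : (JVar → Tm) → ℕ → ℕ
boundSubst σ zero = 0
boundSubst σ (suc n) = boundSubst σ n ⊔ boundTm (σ n)

boundTm≤boundSubst : ∀ σ {v n} → v < n → boundTm (σ v) ≤ boundSubst σ n
boundTm≤boundSubst σ {v} {suc n} v<1+n with v ≟ n
... | yes refl = m≤n⊔m _ _
... | no v≢n = m≤n⇒m≤n⊔o _ (boundTm≤boundSubst σ (≤∧≢⇒< (s≤s⁻¹ v<1+n) v≢n))

-- To substitute σ on the variables below n + 1, move n out of the way to a fresh x,
-- substitute on the variables below n, and finally put σ n in place of x.
⊢SE-subst-↾ : ∀ n → T ⊢SE A → ∀ σ → T ⊢SE A [ σ ↾ n ]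
⊢SE-subst-↾ {A = A} zero ⊢A σ = subst (_ ⊢SE_) (sym ([]-identity _ A λ _ _ → ↾-above σ {0} λ ())) ⊢A
⊢SE-subst-↾ {A = A} (suc n) ⊢A σ =
  subst (_ ⊢SE_) shuffle (jv x (σ n) (⊢SE-subst-↾ n (jv n (var x) ⊢A) σ))
  where
  x : JVar
  x = n ⊔ boundFml A ⊔ boundSubst σ n
  n≤x : n ≤ x
  n≤x = m≤n⇒m≤n⊔o (boundSubst σ n) (m≤m⊔n n (boundFml A))
  A≤x : boundFml A ≤ x
  A≤x = m≤n⇒m≤n⊔o (boundSubst σ n) (m≤n⊔m n (boundFml A))
  σ≤x : boundSubst σ n ≤ x
  σ≤x = m≤n⊔m (n ⊔ boundFml A) (boundSubst σ n)

  pointwise : AgreeBelow (boundFml A) (substTm (single x (σ n)) ∘ substTm (σ ↾ n) ∘ single n (var x))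
                                     (σ ↾ suc n)
  pointwise v v<A with v ≟ n | v <? n
  ... | yes refl | _ = begin
    substTm (single x (σ v)) (substTm (σ ↾ v) (single v (var x) v))
      ≡⟨ cong (substTm (single x (σ v)) ∘ substTm (σ ↾ v)) (single-same v (var x)) ⟩
    substTm (single x (σ v)) ((σ ↾ v) x)  ≡⟨ cong (substTm (single x (σ v))) (↾-above σ (≤⇒≯ n≤x)) ⟩
    single x (σ v) x                       ≡⟨ single-same x (σ v) ⟩
    σ v                                    ≡⟨ ↾-below σ (n<1+n v) ⟨
    (σ ↾ suc v) v                          ∎
  ... | no v≢n | yes v<n = begin
    substTm (single x (σ n)) (substTm (σ ↾ n) (single n (var x) v))
      ≡⟨ cong (substTm (single x (σ n)) ∘ substTm (σ ↾ n)) (single-other (var x) v≢n) ⟩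
    substTm (single x (σ n)) ((σ ↾ n) v)  ≡⟨ cong (substTm (single x (σ n))) (↾-below σ v<n) ⟩
    substTm (single x (σ n)) (σ v)
      ≡⟨ substTm-fresh (σ n) (σ v) (≤-trans (boundTm≤boundSubst σ v<n) σ≤x) ⟩
    σ v                                    ≡⟨ ↾-below σ (m<n⇒m<1+n v<n) ⟨
    (σ ↾ suc n) v                          ∎
  ... | no v≢n | no v≮n = begin
    substTm (single x (σ n)) (substTm (σ ↾ n) (single n (var x) v))
      ≡⟨ cong (substTm (single x (σ n)) ∘ substTm (σ ↾ n)) (single-other (var x) v≢n) ⟩
    substTm (single x (σ n)) ((σ ↾ n) v)  ≡⟨ cong (substTm (single x (σ n))) (↾-above σ v≮n) ⟩
    single x (σ n) v                       ≡⟨ single-other (σ n) (<⇒≢ (<-≤-trans v<A A≤x)) ⟩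
    var v
      ≡⟨ ↾-above σ (λ v<1+n → v≮n (≤∧≢⇒< (s≤s⁻¹ v<1+n) v≢n)) ⟨
    (σ ↾ suc n) v                          ∎

  shuffle : ((A [ n / var x ]) [ σ ↾ n ]) [ x / σ n ] ≡ A [ σ ↾ suc n ]
  shuffle = begin
    ((A [ single n (var x) ]) [ σ ↾ n ]) [ single x (σ n) ]
      ≡⟨ cong (_[ single x (σ n) ]) ([]-∘ _ _ A) ⟩
    (A [ substTm (σ ↾ n) ∘ single n (var x) ]) [ single x (σ n) ]
      ≡⟨ []-∘ _ _ A ⟩
    A [ substTm (single x (σ n)) ∘ substTm (σ ↾ n) ∘ single n (var x) ]
      ≡⟨ []-ext _ _ A pointwise ⟩
    A [ σ ↾ suc n ] ∎

⊢SE-subst : T ⊢SE A → ∀ σ → T ⊢SE A [ σ ]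
⊢SE-subst {A = A} ⊢A σ = subst (_ ⊢SE_) ([]-ext _ σ A λ _ → ↾-below σ) (⊢SE-subst-↾ (boundFml A) ⊢A σ)

infix 2 _⊢_⇔_
_⊢_⇔_ : Theory → Fml → Fml → Set
T ⊢ A ⇔ B = (T ⊢SE A ⇒ B) × (T ⊢SE B ⇒ A)

Interchangeable : Theory → Tm → Tm → Set
Interchangeable T s t = ∀ C w → T ⊢ C [ w / s ] ⇔ C [ w / t ]

interchangeable-refl : ∀ s → Interchangeable T s s
interchangeable-refl s C w = ⇒-refl _ , ⇒-refl _

interchangeable-sym : ∀ {s t} → Interchangeable T s t → Interchangeable T t s
interchangeable-sym s~t C w = proj₂ (s~t C w) , proj₁ (s~t C w)

interchangeable-trans : ∀ {s t u} → Interchangeable T s t → Interchangeable T t u → Interchangeable T s u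
interchangeable-trans s~t t~u C w =
  ⇒-trans (proj₁ (s~t C w)) (proj₁ (t~u C w)) , ⇒-trans (proj₂ (t~u C w)) (proj₂ (s~t C w))

-- A term P is read as a pattern in the variables 0, 1, 2; larger variables also
-- stand for the third argument.
args : Tm → Tm → Tm → JVar → Tm
args s t u 0 = s
args s t u 1 = t
args s t u _ = u

_⟦_,_,_⟧ : Tm → Tm → Tm → Tm → Tm
P ⟦ s , t , u ⟧ = substTm (args s t u) P

⟦⟧-subst : ∀ σ P {s t u s′ t′ u′} → substTm σ s ≡ s′ → substTm σ t ≡ t′ → substTm σ u ≡ u′ →
           substTm σ (P ⟦ s , t , u ⟧) ≡ P ⟦ s′ , t′ , u′ ⟧
⟦⟧-subst σ P {s} {t} {u} {s′} {t′} {u′} σs σt σu =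
  trans (substTm-∘ _ σ P) (substTm-ext _ _ P λ v _ → pointwise v)
  where
  pointwise : ∀ v → substTm σ (args s t u v) ≡ args s′ t′ u′ v
  pointwise 0 = σs
  pointwise 1 = σt
  pointwise (suc (suc _)) = σu

Schema : Theory → Tm → Tm → Set
Schema T P Q = ∀ C w x y z →
  T ⊢SE C [ w / P ⟦ var x , var y , var z ⟧ ] ⇒ C [ w / Q ⟦ var x , var y , var z ⟧ ]

_▷_ : ℕ → (JVar → Tm) → JVar → Tm
(K ▷ ρ) v = if does (v <? K) then var v else ρ (v ∸ K)

▷-below : ∀ {K} ρ {v} → v < K → (K ▷ ρ) v ≡ var v
▷-below {K} ρ {v} = if-yes (v <? K)

▷-shift : ∀ K ρ i → (K ▷ ρ) (K + i) ≡ ρ i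
▷-shift K ρ i = trans (if-no (K + i <? K) (≤⇒≯ (m≤m+n K i))) (cong ρ (m+n∸m≡n K i))

-- An axiom schema stated for variables holds for arbitrary terms: take the variables
-- beyond those of C and substitute the terms for them simultaneously.
schema-instance : ∀ P Q → Schema T P Q → ∀ s t u C w →
                  T ⊢SE C [ w / P ⟦ s , t , u ⟧ ] ⇒ C [ w / Q ⟦ s , t , u ⟧ ]
schema-instance {T} P Q schema s t u C w =
  subst (T ⊢SE_) (cong₂ _⇒_ (instantiate P) (instantiate Q))
        (⊢SE-subst (schema C w (K + 0) (K + 1) (K + 2)) σ)
  where
  K : ℕ
  K = boundFml C
  σ : JVar → Tm
  σ = K ▷ args s t u
  instantiate : ∀ P → (C [ w / P ⟦ var (K + 0) , var (K + 1) , var (K + 2) ⟧ ]) [ σ ]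
                      ≡ C [ w / P ⟦ s , t , u ⟧ ]
  instantiate P = trans ([/]-subst C w _ σ λ _ → ▷-below (args s t u))
                        (cong (λ r → C [ w / r ]) (⟦⟧-subst σ P (shift 0) (shift 1) (shift 2)))
    where
    shift : ∀ i → σ (K + i) ≡ args s t u i
    shift = ▷-shift K (args s t u)

interchangeable-cong : ∀ {s s′} → Interchangeable T s s′ → ∀ H t u →
                       Interchangeable T (H ⟦ s , t , u ⟧) (H ⟦ s′ , t , u ⟧)
interchangeable-cong s~s′ H t u C w =
  subst₂ (_ ⊢_⇔_) (fill _) (fill _) (s~s′ (C [ w / H ⟦ var y , t , u ⟧ ]) y)
  where
  y : JVar
  y = boundFml C ⊔ boundTm t ⊔ boundTm u
  C≤y : boundFml C ≤ y
  C≤y = m≤n⇒m≤n⊔o (boundTm u) (m≤m⊔n (boundFml C) (boundTm t))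
  t≤y : boundTm t ≤ y
  t≤y = m≤n⇒m≤n⊔o (boundTm u) (m≤n⊔m (boundFml C) (boundTm t))
  u≤y : boundTm u ≤ y
  u≤y = m≤n⊔m (boundFml C ⊔ boundTm t) (boundTm u)
  fill : ∀ a → (C [ w / H ⟦ var y , t , u ⟧ ]) [ y / a ] ≡ C [ w / H ⟦ a , t , u ⟧ ]
  fill a = trans ([/]-subst C w _ _ (single-fixes-below a C≤y))
                 (cong (λ r → C [ w / r ])
                       (⟦⟧-subst _ H (single-same y a) (substTm-fresh a t t≤y) (substTm-fresh a u u≤y)))

⇔-schema-interchangeable : ∀ P Q →
  (∀ C w x y z → Axiom (C [ w / P ⟦ var x , var y , var z ⟧ ] ⇔′ C [ w / Q ⟦ var x , var y , var z ⟧ ])) →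
  ∀ s t u → Interchangeable T (P ⟦ s , t , u ⟧) (Q ⟦ s , t , u ⟧)
⇔-schema-interchangeable P Q ax s t u C w =
  schema-instance P Q (λ C w x y z → ∧′-proj₁ (axiom (ax C w x y z))) s t u C w ,
  schema-instance Q P (λ C w x y z → ∧′-proj₂ (axiom (ax C w x y z))) s t u C w

⊕-comm-⇒ : ∀ s t C w → T ⊢SE C [ w / s ⊕ t ] ⇒ C [ w / t ⊕ s ]
⊕-comm-⇒ s t = schema-instance (var 0 ⊕ var 1) (var 1 ⊕ var 0) (λ C w x y _ → axiom (ax-c+ C w x y)) s t 𝟘

⊕-assoc-⇒ : ∀ s t u C w → T ⊢SE C [ w / (s ⊕ t) ⊕ u ] ⇒ C [ w / s ⊕ (t ⊕ u) ]
⊕-assoc-⇒ = schema-instance ((var 0 ⊕ var 1) ⊕ var 2) (var 0 ⊕ (var 1 ⊕ var 2))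
                            (λ C w x y z → axiom (ax-a+ C w x y z))

-- The converse of (a+) is not an axiom; it is obtained by rotating the summands with (c+).
⊕-assoc-⇐ : ∀ s t u C w → T ⊢SE C [ w / s ⊕ (t ⊕ u) ] ⇒ C [ w / (s ⊕ t) ⊕ u ]
⊕-assoc-⇐ s t u C w =
  ⇒-trans (⊕-comm-⇒ s (t ⊕ u) C w) (⇒-trans (⊕-assoc-⇒ t u s C w) (⇒-trans (⊕-comm-⇒ t (u ⊕ s) C w)
    (⇒-trans (⊕-assoc-⇒ u s t C w) (⊕-comm-⇒ u (s ⊕ t) C w))))

≈t⇒interchangeable : ∀ {s t} → s ≈t t → Interchangeable T s t
≈t⇒interchangeable ≈refl = interchangeable-refl _
≈t⇒interchangeable (≈sym t≈s) = interchangeable-sym (≈t⇒interchangeable t≈s)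
≈t⇒interchangeable (≈trans s≈t t≈u) =
  interchangeable-trans (≈t⇒interchangeable s≈t) (≈t⇒interchangeable t≈u)
≈t⇒interchangeable (⊕-cong {s′ = s′} {t} s≈s′ t≈t′) =
  interchangeable-trans (interchangeable-cong (≈t⇒interchangeable s≈s′) (var 0 ⊕ var 1) t 𝟘)
                        (interchangeable-cong (≈t⇒interchangeable t≈t′) (var 1 ⊕ var 0) s′ 𝟘)
≈t⇒interchangeable (·-cong {s′ = s′} {t} s≈s′ t≈t′) =
  interchangeable-trans (interchangeable-cong (≈t⇒interchangeable s≈s′) (var 0 · var 1) t 𝟘)
                        (interchangeable-cong (≈t⇒interchangeable t≈t′) (var 1 · var 0) s′ 𝟘)
≈t⇒interchangeable (⊕-assoc s t u) C w = ⊕-assoc-⇒ s t u C w , ⊕-assoc-⇐ s t u C w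
≈t⇒interchangeable (⊕-comm s t) C w = ⊕-comm-⇒ s t C w , ⊕-comm-⇒ t s C w
≈t⇒interchangeable (⊕-idʳ s) =
  ⇔-schema-interchangeable (var 0 ⊕ 𝟘) (var 0) (λ C w x _ _ → ax-0+ C w x) s 𝟘 𝟘
≈t⇒interchangeable (·-assoc s t u) =
  ⇔-schema-interchangeable ((var 0 · var 1) · var 2) (var 0 · (var 1 · var 2)) ax-am s t u
≈t⇒interchangeable (·-idˡ s) =
  ⇔-schema-interchangeable (𝟙 · var 0) (var 0) (λ C w x _ _ → ax-a1l C w x) s 𝟘 𝟘
≈t⇒interchangeable (·-idʳ s) =
  ⇔-schema-interchangeable (var 0 · 𝟙) (var 0) (λ C w x _ _ → ax-a1r C w x) s 𝟘 𝟘
≈t⇒interchangeable (distˡ s t u) =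
  ⇔-schema-interchangeable (var 0 · (var 1 ⊕ var 2)) (var 0 · var 1 ⊕ var 0 · var 2) ax-dl s t u
≈t⇒interchangeable (distʳ s t u) =
  ⇔-schema-interchangeable ((var 1 ⊕ var 2) · var 0) (var 1 · var 0 ⊕ var 2 · var 0) ax-dr s t u
≈t⇒interchangeable (zeroˡ s) =
  ⇔-schema-interchangeable (𝟘 · var 0) 𝟘 (λ C w x _ _ → ax-a0l C w x) s 𝟘 𝟘
≈t⇒interchangeable (zeroʳ s) =
  ⇔-schema-interchangeable (var 0 · 𝟘) 𝟘 (λ C w x _ _ → ax-a0r C w x) s 𝟘 𝟘

-- Formula contexts, listed from the hole outwards, so that enlarging the context
-- at the hole is just consing a frame.
data Frame : Set where
  ∙⇒_ : Fml → Frame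
  _⇒∙ : Fml → Frame
  _∶∙ : Tm → Frame

fill : Frame → Fml → Fml
fill (∙⇒ B) X = X ⇒ B
fill (A ⇒∙) X = A ⇒ X
fill (t ∶∙) X = t ∶ X

boundFrame : Frame → ℕ
boundFrame (∙⇒ B) = boundFml B
boundFrame (A ⇒∙) = boundFml A
boundFrame (t ∶∙) = boundTm t

plug : List Frame → Fml → Fml
plug [] X = X
plug (f ∷ K) X = plug K (fill f X)

boundContext : List Frame → ℕ
boundContext [] = 0
boundContext (f ∷ K) = boundFrame f ⊔ boundContext K

fill-[/] : ∀ f X {w} s → boundFrame f ≤ w → (fill f X) [ w / s ] ≡ fill f (X [ w / s ])
fill-[/] (∙⇒ B) X s B≤w = cong (X [ _ / s ] ⇒_) ([]-fresh s B B≤w)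
fill-[/] (A ⇒∙) X s A≤w = cong (_⇒ X [ _ / s ]) ([]-fresh s A A≤w)
fill-[/] (t ∶∙) X s t≤w = cong (_∶ X [ _ / s ]) (substTm-fresh s t t≤w)

plug-[/] : ∀ K X {w} s → boundContext K ≤ w → (plug K X) [ w / s ] ≡ plug K (X [ w / s ])
plug-[/] [] X s _ = refl
plug-[/] (f ∷ K) X s fK≤w =
  trans (plug-[/] K (fill f X) s (m⊔n≤o⇒n≤o _ _ fK≤w))
        (cong (plug K) (fill-[/] f X s (m⊔n≤o⇒m≤o _ _ fK≤w)))

interchangeable-plug : ∀ {s t} → Interchangeable T s t → ∀ K A → T ⊢SE plug K (s ∶ A) ⇒ plug K (t ∶ A)
interchangeable-plug {T} s~t K A =
  subst₂ (λ X Y → T ⊢SE X ⇒ Y) (hole _) (hole _) (proj₁ (s~t (plug K (var w ∶ A)) w))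
  where
  w : JVar
  w = boundContext K ⊔ boundFml A
  hole : ∀ a → (plug K (var w ∶ A)) [ w / a ] ≡ plug K (a ∶ A)
  hole a = trans (plug-[/] K _ a (m≤m⊔n _ _))
                 (cong (plug K) (cong₂ _∶_ (single-same w a) ([]-fresh a A (m≤n⊔m _ _))))

≈f-plug : A ≈f B → ∀ K → T ⊢SE plug K A ⇒ plug K B
≈f-plug ⊥≈ K = ⇒-refl _
≈f-plug (atom≈ P) K = ⇒-refl _
≈f-plug (⇒≈ {A′ = A′} {B} A≈A′ B≈B′) K =
  ⇒-trans (≈f-plug A≈A′ ((∙⇒ B) ∷ K)) (≈f-plug B≈B′ ((A′ ⇒∙) ∷ K))
≈f-plug (∶≈ {t = t} {A} s≈t A≈B) K =
  ⇒-trans (interchangeable-plug (≈t⇒interchangeable s≈t) K A) (≈f-plug A≈B ((t ∶∙) ∷ K))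

≈f⇒⊢SE : A ≈f B → T ⊢SE A ⇒ B
≈f⇒⊢SE A≈B = ≈f-plug A≈B []

≈f-sym : A ≈f B → B ≈f A
≈f-sym ⊥≈ = ⊥≈
≈f-sym (atom≈ P) = atom≈ P
≈f-sym (⇒≈ A≈A′ B≈B′) = ⇒≈ (≈f-sym A≈A′) (≈f-sym B≈B′)
≈f-sym (∶≈ s≈t A≈B) = ∶≈ (≈sym s≈t) (≈f-sym A≈B)

module _ {Prop₂ : Set} (F : Tm → Fml → Prop₂) where
  ⊢SE⇒⊢CL-subst : T ⊢SE A → ∀ σ → prime F T ⊢CL tr F (A [ σ ])
  ⊢SE⇒⊢CL-subst (axiom a) σ = hyp (_ , σ , inj₂ a , refl)
  ⊢SE⇒⊢CL-subst (hyp h) σ = hyp (_ , σ , inj₁ h , refl)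
  ⊢SE⇒⊢CL-subst (mp ⊢A⇒B ⊢A) σ = mp (⊢SE⇒⊢CL-subst ⊢A⇒B σ) (⊢SE⇒⊢CL-subst ⊢A σ)
  ⊢SE⇒⊢CL-subst {T} (jv {A} x t ⊢A) σ =
    subst (λ B → prime F T ⊢CL tr F B) (sym ([]-∘ (single x t) σ A)) (⊢SE⇒⊢CL-subst ⊢A _)

  ⊢SE⇒⊢CL : T ⊢SE A → prime F T ⊢CL tr F A
  ⊢SE⇒⊢CL {T} {A} ⊢A = subst (λ B → prime F T ⊢CL tr F B) ([]-var A) (⊢SE⇒⊢CL-subst ⊢A var)

module _ {Prop₂ : Set} (F : Tm → Fml → Prop₂) (bij : IsClassBijection Prop₂ F) where
  private
    preimage : (p : Prop₂) → Σ Tm λ t → Σ Fml λ A → F t A ≡ p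
    preimage = proj₂ (proj₂ bij)

  readBack : PF (Prop ⊎ Prop₂) → Fml
  readBack ⊥ᶜ = ⊥′
  readBack (atomᶜ (inj₁ P)) = atom P
  readBack (atomᶜ (inj₂ p)) = proj₁ (preimage p) ∶ proj₁ (proj₂ (preimage p))
  readBack (A ⇒ᶜ B) = readBack A ⇒ readBack B

  valuation : (Prop → Bool) → (Tm → Fml → Bool) → Prop ⊎ Prop₂ → Bool
  valuation v u = [ v , (λ p → u (proj₁ (preimage p)) (proj₁ (proj₂ (preimage p)))) ]′

  evalSE-readBack : ∀ v u B → evalSE v u (readBack B) ≡ evalᶜ (valuation v u) B
  evalSE-readBack v u ⊥ᶜ = refl
  evalSE-readBack v u (atomᶜ (inj₁ P)) = refl
  evalSE-readBack v u (atomᶜ (inj₂ p)) = refl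
  evalSE-readBack v u (A ⇒ᶜ B) = cong₂ _⇒ᵇ_ (evalSE-readBack v u A) (evalSE-readBack v u B)

  readBack-tr : ∀ A → readBack (tr F A) ≈f A
  readBack-tr ⊥′ = ⊥≈
  readBack-tr (atom P) = atom≈ P
  readBack-tr (A ⇒ B) = ⇒≈ (readBack-tr A) (readBack-tr B)
  readBack-tr (t ∶ A) with preimage (F t A)
  ... | t′ , A′ , Ft′A′≡FtA = uncurry ∶≈ (proj₁ bij t′ t A′ A Ft′A′≡FtA)

  ⊢CL⇒⊢SE-readBack : ∀ {B} → prime F T ⊢CL B → T ⊢SE readBack B
  ⊢CL⇒⊢SE-readBack (taut {B} ⊨B) = tautology λ v u → trans (evalSE-readBack v u B) (⊨B (valuation v u))
  ⊢CL⇒⊢SE-readBack (hyp (A , σ , A∈T⊎axiom , refl)) =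
    mp (≈f⇒⊢SE (≈f-sym (readBack-tr (A [ σ ])))) (⊢SE-subst ([ hyp , axiom ]′ A∈T⊎axiom) σ)
  ⊢CL⇒⊢SE-readBack (mp ⊢A⇒B ⊢A) = mp (⊢CL⇒⊢SE-readBack ⊢A⇒B) (⊢CL⇒⊢SE-readBack ⊢A)

  ⊢CL⇒⊢SE : prime F T ⊢CL tr F A → T ⊢SE A
  ⊢CL⇒⊢SE {A = A} ⊢A′ = mp (≈f⇒⊢SE (readBack-tr A)) (⊢CL⇒⊢SE-readBack ⊢A′)

mainTheorem14 : (Prop₂ : Set) (F : Tm → Fml → Prop₂) → IsClassBijection Prop₂ F →
    (T : Theory) (A : Fml) →
    ((T ⊢SE A) → (prime F T ⊢CL tr F A)) × ((prime F T ⊢CL tr F A) → (T ⊢SE A))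
mainTheorem14 Prop₂ F bij T A = ⊢SE⇒⊢CL F , ⊢CL⇒⊢SE F bij
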